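{- (a) The path $P_1$ defines the CP-graph $K_1$. (b) The path $P_2$ defines the CP-graph $\overline{K_2}$. (c) The path $P_3$ defines the CP-graph $K_1\cup K_2$. (d) For every integer $k\ge 4$, the path $P_k$ defines neither $\overline{K_2}$ nor $K_1\cup K_2$.
   Context: For a graph $G$ with vertex set $V$, a set $S\subseteq V$ is a dominating set if every vertex of $V\setminus S$ is adjacent to a vertex of $S$. Two disjoint sets $V_1,V_2\subseteq V$ form a coalition in $G$ if neither is a dominating set of $G$ but $V_1\cup V_2$ is. A coalition partition of $G$ is a partition $\Psi=\{V_1,\ldots,V_k\}$ of $V$ such that every $V_i\in\Psi$ is either a dominating set of $G$ with $|V_i|=1$, or is not a dominating set and forms a coalition with some $V_j\in\Psi$. Given a coalition partition $\Psi$ of $G$, the coalition graph $\mathrm{CG}(G,\Psi)$ has vertex set $\Psi$, two members being adjacent iff they form a coalition in $G$. $P_k$ denotes the path on $k$ vertices. A path $P_k$ defines a graph $H$ (a CP-graph) if there is a coalition partition $\Psi$ of $P_k$ with $\mathrm{CG}(P_k,\Psi)\cong H$. $\overline{K_2}$ is the edgeless graph on two vertices and $K_1\cup K_2$ the disjoint union of a vertex and an edge. -}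

module Defs where

open import Data.Nat using (ℕ; suc)
open import Data.Fin using (Fin; toℕ)
open import Data.Product using (Σ; ∃; _×_)
open import Data.Sum using (_⊎_)
open import Data.Empty using (⊥)
open import Relation.Nullary using (¬_)
open import Relation.Binary.PropositionalEquality using (_≡_)
open import Function.Bundles using (_↔_; Inverse)

PathAdj : (n : ℕ) → Fin n → Fin n → Set
PathAdj n i j = (suc (toℕ i) ≡ toℕ j) ⊎ (suc (toℕ j) ≡ toℕ i)

Dominating : (n : ℕ) → (Fin n → Set) → Set
Dominating n S = ∀ v → S v ⊎ (Σ (Fin n) λ u → PathAdj n v u × S u)

-- A partition of V(P_n) into m (nonempty) parts, given by a surjective
-- labelling c : Fin n → Fin m; part i is {v | c v ≡ i}.
Part : {n m : ℕ} → (Fin n → Fin m) → Fin m → Fin n → Set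
Part c i v = c v ≡ i

Surj : {n m : ℕ} → (Fin n → Fin m) → Set
Surj {n} {m} c = ∀ (i : Fin m) → Σ (Fin n) λ v → c v ≡ i

-- Parts i and j form a coalition in P_n (parts of a partition are disjoint
-- for i ≢ j; for i ≡ j the condition is unsatisfiable).
Coalition : {n m : ℕ} → (Fin n → Fin m) → Fin m → Fin m → Set
Coalition {n} c i j =
  ¬ Dominating n (Part c i) × ¬ Dominating n (Part c j)
  × Dominating n (λ v → Part c i v ⊎ Part c j v)

Singleton : {n m : ℕ} → (Fin n → Fin m) → Fin m → Set
Singleton {n} c i = Σ (Fin n) λ v → ∀ u → (c u ≡ i → u ≡ v) × (u ≡ v → c u ≡ i)

IsCoalitionPartition : {n m : ℕ} → (Fin n → Fin m) → Set
IsCoalitionPartition {n} {m} c =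
  Surj c ×
  (∀ (i : Fin m) →
     (Dominating n (Part c i) × Singleton c i)
     ⊎ (¬ Dominating n (Part c i) × (Σ (Fin m) λ j → Coalition c i j)))

Defines : (n r : ℕ) → (Fin r → Fin r → Set) → Set
Defines n r HAdj =
  Σ ℕ λ m → Σ (Fin n → Fin m) λ c → IsCoalitionPartition c ×
    (Σ (Fin m ↔ Fin r) λ σ →
       ∀ i j → (Coalition c i j → HAdj (Inverse.to σ i) (Inverse.to σ j))
             × (HAdj (Inverse.to σ i) (Inverse.to σ j) → Coalition c i j))

K1Adj : Fin 1 → Fin 1 → Set
K1Adj _ _ = ⊥

K2barAdj : Fin 2 → Fin 2 → Set
K2barAdj _ _ = ⊥

K1∪K2Adj : Fin 3 → Fin 3 → Set
K1∪K2Adj i j = (toℕ i ≡ 1 × toℕ j ≡ 2) ⊎ (toℕ i ≡ 2 × toℕ j ≡ 1)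

-- For k ≥ 4 no single vertex dominates P_k, so every part of a coalition
-- partition of P_k is non-dominating and hence has a coalition partner: the
-- coalition graph has no isolated vertex, whereas both K̄₂ and K₁ ∪ K₂ do.
-- For k ≤ 3 explicit partitions suffice: the singletons of P_1 and P_2 all
-- dominate, and P_3 splits into its middle vertex, which dominates, and its
-- two ends, which form the only coalition.
module Submission where

open import Defs
open import Data.Nat as ℕ using (ℕ; _≤_; s≤s)
open import Data.Fin using (Fin; toℕ; zero; suc)
open import Data.Product using (Σ; _×_; _,_; proj₁; proj₂)
open import Data.Sum using (_⊎_; inj₁; inj₂; reduce; swap)
open import Data.Empty using (⊥-elim)
open import Function using (id; const; _∘_)
open import Function.Bundles using (Inverse)
open import Function.Construct.Identity using (↔-id)
open import Relation.Nullary using (¬_)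
open import Relation.Binary.PropositionalEquality using (_≡_; refl; subst)

Dominating-mono : ∀ {n} {S T : Fin n → Set} →
                  (∀ v → S v → T v) → Dominating n S → Dominating n T
Dominating-mono S⊆T dom v with dom v
... | inj₁ s = inj₁ (S⊆T v s)
... | inj₂ (u , v~u , s) = inj₂ (u , v~u , S⊆T u s)

vertex-dominating⇒close : ∀ {n} {v : Fin n} → Dominating n (_≡ v) →
                          ∀ u → toℕ u ≡ toℕ v ⊎ PathAdj n u v
vertex-dominating⇒close dom u with dom u
... | inj₁ refl = inj₁ refl
... | inj₂ (w , u~w , refl) = inj₂ u~w

-- Distance ≤ 1 from both 0 and 3 is impossible.
no-vertex-dominating : ∀ {n} → 4 ≤ n → (v : Fin n) → ¬ Dominating n (_≡ v)
no-vertex-dominating (s≤s (s≤s (s≤s (s≤s _)))) v dom =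
  apart (toℕ v) (vertex-dominating⇒close dom zero)
                (vertex-dominating⇒close dom (suc (suc (suc zero))))
  where
  apart : ∀ t → 0 ≡ t ⊎ (1 ≡ t ⊎ ℕ.suc t ≡ 0) → ¬ (3 ≡ t ⊎ (4 ≡ t ⊎ ℕ.suc t ≡ 3))
  apart .0 (inj₁ refl)        (inj₂ (inj₂ ()))
  apart .1 (inj₂ (inj₁ refl)) (inj₂ (inj₂ ()))
  apart t  (inj₂ (inj₂ ()))   _

module _ {n m : ℕ} (c : Fin n → Fin m) where

  Coalition-sym : ∀ {i j} → Coalition c i j → Coalition c j i
  Coalition-sym (¬domᵢ , ¬domⱼ , dom) = ¬domⱼ , ¬domᵢ , Dominating-mono (λ _ → swap) dom

  Coalition-irrefl : ∀ {i} → ¬ Coalition c i i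
  Coalition-irrefl (¬dom , _ , dom) = ¬dom (Dominating-mono (λ _ → reduce) dom)

  dominating⇒¬Coalitionˡ : ∀ {i j} → Dominating n (Part c i) → ¬ Coalition c i j
  dominating⇒¬Coalitionˡ dom (¬dom , _) = ¬dom dom

  dominating⇒¬Coalitionʳ : ∀ {i j} → Dominating n (Part c j) → ¬ Coalition c i j
  dominating⇒¬Coalitionʳ dom = dominating⇒¬Coalitionˡ dom ∘ Coalition-sym

  singleton-dominating : ∀ {i} → Singleton c i → Dominating n (Part c i) →
                         Σ (Fin n) λ v → Dominating n (_≡ v)
  singleton-dominating (v , part≡v) dom =
    v , Dominating-mono (λ u → proj₁ (part≡v u)) dom

  has-coalition-partner : 4 ≤ n → IsCoalitionPartition c →
                          ∀ i → Σ (Fin m) (Coalition c i)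
  has-coalition-partner 4≤n (_ , parts) i with parts i
  ... | inj₁ (dom , single) =
    let (v , v-dom) = singleton-dominating single dom
    in ⊥-elim (no-vertex-dominating 4≤n v v-dom)
  ... | inj₂ (_ , partner) = partner

Defines⇒no-isolated : ∀ {n r} {H : Fin r → Fin r → Set} → 4 ≤ n →
                      Defines n r H → ∀ x → Σ (Fin r) (H x)
Defines⇒no-isolated {H = H} 4≤n (_ , c , partition , σ , iso) x
  with has-coalition-partner c 4≤n partition (Inverse.from σ x)
... | j , co = Inverse.to σ j
             , subst (λ y → H y (Inverse.to σ j)) (Inverse.strictlyInverseˡ σ x)
                     (proj₁ (iso _ j) co)

singletons-define-edgeless : ∀ {n} {H : Fin n → Fin n → Set} →
                             (∀ v → Dominating n (_≡ v)) → (∀ i j → ¬ H i j) →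
                             Defines n n H
singletons-define-edgeless dom edgeless =
  _ , id , ((λ i → i , refl) , λ i → inj₁ (dom i , i , λ _ → id , id))
    , ↔-id _ , λ i j → ⊥-elim ∘ dominating⇒¬Coalitionˡ id (dom i)
                     , ⊥-elim ∘ edgeless i j

P₁-vertex-dominating : ∀ v → Dominating 1 (_≡ v)
P₁-vertex-dominating zero zero = inj₁ refl

P₂-vertex-dominating : ∀ v → Dominating 2 (_≡ v)
P₂-vertex-dominating zero       zero       = inj₁ refl
P₂-vertex-dominating zero       (suc zero) = inj₂ (zero , inj₂ refl , refl)
P₂-vertex-dominating (suc zero) zero       = inj₂ (suc zero , inj₁ refl , refl)
P₂-vertex-dominating (suc zero) (suc zero) = inj₁ refl

K1∪K2-isolatedˡ : ∀ j → ¬ K1∪K2Adj zero j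
K1∪K2-isolatedˡ _ (inj₁ (() , _))
K1∪K2-isolatedˡ _ (inj₂ (() , _))

K1∪K2-isolatedʳ : ∀ i → ¬ K1∪K2Adj i zero
K1∪K2-isolatedʳ _ (inj₁ (_ , ()))
K1∪K2-isolatedʳ _ (inj₂ (_ , ()))

K1∪K2-irrefl : ∀ i → ¬ K1∪K2Adj i i
K1∪K2-irrefl zero             = K1∪K2-isolatedˡ zero
K1∪K2-irrefl (suc zero)       (inj₁ (_ , ()))
K1∪K2-irrefl (suc zero)       (inj₂ (() , _))
K1∪K2-irrefl (suc (suc zero)) (inj₁ (() , _))
K1∪K2-irrefl (suc (suc zero)) (inj₂ (_ , ()))

P₃-partition : Fin 3 → Fin 3
P₃-partition zero             = suc zero
P₃-partition (suc zero)       = zero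
P₃-partition (suc (suc zero)) = suc (suc zero)

P₃-middle-dominating : Dominating 3 (Part P₃-partition zero)
P₃-middle-dominating zero             = inj₂ (suc zero , inj₁ refl , refl)
P₃-middle-dominating (suc zero)       = inj₁ refl
P₃-middle-dominating (suc (suc zero)) = inj₂ (suc zero , inj₂ refl , refl)

P₃-left-¬dominating : ¬ Dominating 3 (Part P₃-partition (suc zero))
P₃-left-¬dominating dom with dom (suc (suc zero))
... | inj₁ ()
... | inj₂ (zero , inj₁ () , _)
... | inj₂ (zero , inj₂ () , _)
... | inj₂ (suc zero , _ , ())
... | inj₂ (suc (suc zero) , _ , ())

P₃-right-¬dominating : ¬ Dominating 3 (Part P₃-partition (suc (suc zero)))
P₃-right-¬dominating dom with dom zero
... | inj₁ ()
... | inj₂ (zero , _ , ())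
... | inj₂ (suc zero , _ , ())
... | inj₂ (suc (suc zero) , inj₁ () , _)
... | inj₂ (suc (suc zero) , inj₂ () , _)

P₃-ends-coalition : Coalition P₃-partition (suc zero) (suc (suc zero))
P₃-ends-coalition = P₃-left-¬dominating , P₃-right-¬dominating , dom
  where
  dom : Dominating 3 (λ v → Part P₃-partition (suc zero) v ⊎ Part P₃-partition (suc (suc zero)) v)
  dom zero             = inj₁ (inj₁ refl)
  dom (suc zero)       = inj₂ (zero , inj₂ refl , inj₁ refl)
  dom (suc (suc zero)) = inj₁ (inj₂ refl)

P₃-is-coalition-partition : IsCoalitionPartition P₃-partition
P₃-is-coalition-partition = surjective , parts
  where
  surjective : Surj P₃-partition
  surjective zero             = suc zero , refl
  surjective (suc zero)       = zero , refl
  surjective (suc (suc zero)) = suc (suc zero) , refl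

  middle-singleton : Singleton P₃-partition zero
  middle-singleton = suc zero , λ
    { zero             → (λ ()) , (λ ())
    ; (suc zero)       → const refl , const refl
    ; (suc (suc zero)) → (λ ()) , (λ ()) }

  parts : ∀ i → (Dominating 3 (Part P₃-partition i) × Singleton P₃-partition i)
              ⊎ (¬ Dominating 3 (Part P₃-partition i) × Σ (Fin 3) (Coalition P₃-partition i))
  parts zero             = inj₁ (P₃-middle-dominating , middle-singleton)
  parts (suc zero)       = inj₂ (P₃-left-¬dominating , suc (suc zero) , P₃-ends-coalition)
  parts (suc (suc zero)) = inj₂ (P₃-right-¬dominating , suc zero , Coalition-sym P₃-partition P₃-ends-coalition)

P₃-coalition-graph : ∀ i j → (Coalition P₃-partition i j → K1∪K2Adj i j)
                           × (K1∪K2Adj i j → Coalition P₃-partition i j)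
P₃-coalition-graph zero j =
  ⊥-elim ∘ dominating⇒¬Coalitionˡ P₃-partition P₃-middle-dominating , ⊥-elim ∘ K1∪K2-isolatedˡ j
P₃-coalition-graph i zero =
  ⊥-elim ∘ dominating⇒¬Coalitionʳ P₃-partition P₃-middle-dominating , ⊥-elim ∘ K1∪K2-isolatedʳ i
P₃-coalition-graph (suc zero) (suc zero) =
  ⊥-elim ∘ Coalition-irrefl P₃-partition , ⊥-elim ∘ K1∪K2-irrefl (suc zero)
P₃-coalition-graph (suc zero) (suc (suc zero)) =
  const (inj₁ (refl , refl)) , const P₃-ends-coalition
P₃-coalition-graph (suc (suc zero)) (suc zero) =
  const (inj₂ (refl , refl)) , const (Coalition-sym P₃-partition P₃-ends-coalition)
P₃-coalition-graph (suc (suc zero)) (suc (suc zero)) =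
  ⊥-elim ∘ Coalition-irrefl P₃-partition , ⊥-elim ∘ K1∪K2-irrefl (suc (suc zero))

proposition3 : Defines 1 1 K1Adj × Defines 2 2 K2barAdj × Defines 3 3 K1∪K2Adj
    × (∀ (k : ℕ) → 4 ≤ k → ¬ Defines k 2 K2barAdj × ¬ Defines k 3 K1∪K2Adj)
proposition3 =
    singletons-define-edgeless P₁-vertex-dominating (λ _ _ → id)
  , singletons-define-edgeless P₂-vertex-dominating (λ _ _ → id)
  , (_ , P₃-partition , P₃-is-coalition-partition , ↔-id _ , P₃-coalition-graph)
  , λ k 4≤k →
      (λ defines → proj₂ (Defines⇒no-isolated {H = K2barAdj} 4≤k defines zero))
    , (λ defines → let (y , adj) = Defines⇒no-isolated {H = K1∪K2Adj} 4≤k defines zero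
                   in K1∪K2-isolatedˡ y adj)
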